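{- Let $A$ be an MV-monoidal algebra and let $\mathbf a=(a_0,a_1,\dots)$, $\mathbf b=(b_0,b_1,\dots)$ be good sequences in $A$. Then the sequence $\mathbf a+\mathbf b=(c_0,c_1,\dots)$ with $c_n=(a_0\oplus b_n)\odot(a_1\oplus b_{n-1})\odot\dots\odot(a_n\oplus b_0)$ is a good sequence.
   Context: An MV-monoidal algebra is an algebra $\langle A;\oplus,\odot,\vee,\wedge,0,1\rangle$ satisfying: $\langle A;\vee,\wedge\rangle$ is a distributive lattice; $\langle A;\oplus,0\rangle$ and $\langle A;\odot,1\rangle$ are commutative monoids; $\oplus$ and $\odot$ both distribute over both $\vee$ and $\wedge$; $(x\oplus y)\odot((x\odot y)\oplus z)=(x\odot(y\oplus z))\oplus(y\odot z)$; $(x\odot y)\oplus((x\oplus y)\odot z)=(x\oplus(y\odot z))\odot(y\oplus z)$; $(x\odot y)\oplus z=((x\oplus y)\odot((x\odot y)\oplus z))\vee z$; $(x\oplus y)\odot z=((x\odot y)\oplus((x\oplus y)\odot z))\wedge z$. A good pair is $(x_0,x_1)$ with $x_0\oplus x_1=x_0$ and $x_0\odot x_1=x_1$; a good sequence is a sequence in $A$, eventually $0$, in which every two consecutive terms form a good pair. -}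

module Defs where

open import Level using (Level)
open import Data.Nat using (ℕ; zero; suc; _∸_; _≤_)
open import Data.Product using (∃; _×_)
open import Relation.Binary.PropositionalEquality using (_≡_)

record MVMonoidal (ℓ : Level) : Set (Level.suc ℓ) where
  infixl 6 _⊕_
  infixl 7 _⊙_
  infixl 5 _∨_
  infixl 5 _∧_
  field
    Carrier : Set ℓ
    _⊕_ _⊙_ _∨_ _∧_ : Carrier → Carrier → Carrier
    𝟘 𝟙 : Carrier
    ∨-assoc : ∀ x y z → (x ∨ y) ∨ z ≡ x ∨ (y ∨ z)
    ∨-comm  : ∀ x y → x ∨ y ≡ y ∨ x
    ∧-assoc : ∀ x y z → (x ∧ y) ∧ z ≡ x ∧ (y ∧ z)
    ∧-comm  : ∀ x y → x ∧ y ≡ y ∧ x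
    ∨-absorbs-∧ : ∀ x y → x ∨ (x ∧ y) ≡ x
    ∧-absorbs-∨ : ∀ x y → x ∧ (x ∨ y) ≡ x
    ∧-distribˡ-∨ : ∀ x y z → x ∧ (y ∨ z) ≡ (x ∧ y) ∨ (x ∧ z)
    ⊕-assoc : ∀ x y z → (x ⊕ y) ⊕ z ≡ x ⊕ (y ⊕ z)
    ⊕-comm  : ∀ x y → x ⊕ y ≡ y ⊕ x
    ⊕-identityʳ : ∀ x → x ⊕ 𝟘 ≡ x
    ⊙-assoc : ∀ x y z → (x ⊙ y) ⊙ z ≡ x ⊙ (y ⊙ z)
    ⊙-comm  : ∀ x y → x ⊙ y ≡ y ⊙ x
    ⊙-identityʳ : ∀ x → x ⊙ 𝟙 ≡ x
    -- ⊕ and ⊙ distribute over ∨ and ∧ (commutativity gives the other side)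
    ⊕-distribˡ-∨ : ∀ x y z → x ⊕ (y ∨ z) ≡ (x ⊕ y) ∨ (x ⊕ z)
    ⊕-distribˡ-∧ : ∀ x y z → x ⊕ (y ∧ z) ≡ (x ⊕ y) ∧ (x ⊕ z)
    ⊙-distribˡ-∨ : ∀ x y z → x ⊙ (y ∨ z) ≡ (x ⊙ y) ∨ (x ⊙ z)
    ⊙-distribˡ-∧ : ∀ x y z → x ⊙ (y ∧ z) ≡ (x ⊙ y) ∧ (x ⊙ z)
    ax1 : ∀ x y z → (x ⊕ y) ⊙ ((x ⊙ y) ⊕ z) ≡ (x ⊙ (y ⊕ z)) ⊕ (y ⊙ z)
    ax2 : ∀ x y z → (x ⊙ y) ⊕ ((x ⊕ y) ⊙ z) ≡ (x ⊕ (y ⊙ z)) ⊙ (y ⊕ z)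
    ax3 : ∀ x y z → (x ⊙ y) ⊕ z ≡ ((x ⊕ y) ⊙ ((x ⊙ y) ⊕ z)) ∨ z
    ax4 : ∀ x y z → (x ⊕ y) ⊙ z ≡ ((x ⊙ y) ⊕ ((x ⊕ y) ⊙ z)) ∧ z

module _ {ℓ : Level} (A : MVMonoidal ℓ) where
  open MVMonoidal A

  GoodPair : Carrier → Carrier → Set ℓ
  GoodPair x₀ x₁ = (x₀ ⊕ x₁ ≡ x₀) × (x₀ ⊙ x₁ ≡ x₁)

  GoodSeq : (ℕ → Carrier) → Set ℓ
  GoodSeq a = (∃ λ N → ∀ n → N ≤ n → a n ≡ 𝟘) × (∀ n → GoodPair (a n) (a (suc n)))

  ⊙-upTo : (ℕ → Carrier) → ℕ → Carrier
  ⊙-upTo f zero    = f zero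
  ⊙-upTo f (suc n) = ⊙-upTo f n ⊙ f (suc n)

  seqSum : (ℕ → Carrier) → (ℕ → Carrier) → ℕ → Carrier
  seqSum a b n = ⊙-upTo (λ i → a i ⊕ b (n ∸ i)) n

-- Two good pairs (x₀, x₁) and (y₀, y₁) combine into the good pair
-- (x₀ ⊕ y₀, (x₀ ⊕ y₁) ⊙ (x₁ ⊕ y₀)).  A good pair (p, q) stays good when q is
-- multiplied by anything, and good pairs (p, q), (r, q) give the good pair
-- (p ⊙ r, q).  Now cₙ₊₁ contains the adjacent factors
-- (aᵢ ⊕ bₙ₊₁₋ᵢ) ⊙ (aᵢ₊₁ ⊕ bₙ₋ᵢ), so every factor aᵢ ⊕ bₙ₋ᵢ of cₙ forms a good
-- pair with cₙ₊₁, and hence so does their product cₙ.  If aₙ = 0 for n ≥ N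
-- and bₙ = 0 for n ≥ M, then for n ≥ N + M the factor a_N ⊕ b_{n-N} of cₙ is 0.
module Submission where

open import Level using (Level)
open import Algebra.Bundles using (CommutativeMonoid)
open import Algebra.Lattice.Bundles using (Lattice)
import Relation.Binary.Lattice.Bundles as OrderTheoretic
open import Data.Nat using (ℕ; zero; suc; _+_; _∸_; _≤_; z≤n; s≤s; _≤′_; ≤′-refl; ≤′-step)
open import Data.Nat.Properties using (≤⇒≤′; ≤-refl; m≤n⇒m≤1+n; +-∸-assoc; m+n≤o⇒n≤o; m+n≤o⇒m≤o∸n)
open import Data.Product using (∃; _,_; proj₁)
open import Relation.Binary.PropositionalEquality
open import Defs

module MVMonoidalProperties {ℓ : Level} (A : MVMonoidal ℓ) where
  open MVMonoidal A
  open ≡-Reasoning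

  lattice : Lattice ℓ ℓ
  lattice = record
    { isLattice = record
      { isEquivalence = isEquivalence
      ; ∨-comm = ∨-comm ; ∨-assoc = ∨-assoc ; ∨-cong = cong₂ _∨_
      ; ∧-comm = ∧-comm ; ∧-assoc = ∧-assoc ; ∧-cong = cong₂ _∧_
      ; absorptive = ∨-absorbs-∧ , ∧-absorbs-∨
      }
    }

  -- x ⊑ y is x ≡ x ∧ y.
  open import Algebra.Lattice.Properties.Lattice lattice using (∨-idem; ∨-∧-orderTheoreticLattice)
  open OrderTheoretic.Lattice ∨-∧-orderTheoreticLattice
    using (antisym; x∧y≤y; y≤x∨y)
    renaming (_≤_ to _⊑_; trans to ⊑-trans; reflexive to ⊑-reflexive)

  private
    commutativeMonoid : (_∙_ : Carrier → Carrier → Carrier) (ε : Carrier) →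
      (∀ x y z → (x ∙ y) ∙ z ≡ x ∙ (y ∙ z)) → (∀ x y → x ∙ y ≡ y ∙ x) →
      (∀ x → x ∙ ε ≡ x) → CommutativeMonoid ℓ ℓ
    commutativeMonoid _∙_ ε assoc comm identityʳ = record
      { isCommutativeMonoid = record
        { isMonoid = record
          { isSemigroup = record
            { isMagma = record { isEquivalence = isEquivalence ; ∙-cong = cong₂ _∙_ }
            ; assoc = assoc
            }
          ; identity = (λ x → trans (comm ε x) (identityʳ x)) , identityʳ
          }
        ; comm = comm
        }
      }

  ⊕-commutativeMonoid : CommutativeMonoid ℓ ℓ
  ⊕-commutativeMonoid = commutativeMonoid _⊕_ 𝟘 ⊕-assoc ⊕-comm ⊕-identityʳ

  ⊙-commutativeMonoid : CommutativeMonoid ℓ ℓ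
  ⊙-commutativeMonoid = commutativeMonoid _⊙_ 𝟙 ⊙-assoc ⊙-comm ⊙-identityʳ

  open import Algebra.Properties.CommutativeSemigroup
    (CommutativeMonoid.commutativeSemigroup ⊕-commutativeMonoid)
    using () renaming (interchange to ⊕-interchange)
  open import Algebra.Properties.CommutativeSemigroup
    (CommutativeMonoid.commutativeSemigroup ⊙-commutativeMonoid)
    using () renaming (x∙yz≈y∙xz to ⊙-x∙yz≡y∙xz)
  open import Algebra.Properties.Monoid.Divisibility
    (CommutativeMonoid.monoid ⊙-commutativeMonoid)
    using (_∣_; _,_; ∣ʳ-refl; ∣ʳ-trans; x∣ʳyx; x∣ʳy⇒xz∣ʳyz)
  open import Algebra.Properties.CommutativeSemigroup.Divisibility
    (CommutativeMonoid.commutativeSemigroup ⊙-commutativeMonoid)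
    using (x∣xy)

  x⊙y⊑y : ∀ x y → x ⊙ y ⊑ y
  x⊙y⊑y x y =
    ⊑-trans (⊑-reflexive (trans (cong (_⊙ y) (sym (⊕-identityʳ x))) (ax4 x 𝟘 y))) (x∧y≤y _ y)

  y⊑x⊕y : ∀ x y → y ⊑ x ⊕ y
  y⊑x⊕y x y =
    ⊑-trans (y≤x∨y _ y) (⊑-reflexive (sym (trans (cong (_⊕ y) (sym (⊙-identityʳ x))) (ax3 x 𝟙 y))))

  ⊙-zeroʳ : ∀ x → x ⊙ 𝟘 ≡ 𝟘
  ⊙-zeroʳ x = antisym (x⊙y⊑y x 𝟘) (subst (𝟘 ⊑_) (⊕-identityʳ (x ⊙ 𝟘)) (y⊑x⊕y (x ⊙ 𝟘) 𝟘))

  ⊕-zeroʳ : ∀ x → x ⊕ 𝟙 ≡ 𝟙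
  ⊕-zeroʳ x = antisym (subst (_⊑ 𝟙) (⊙-identityʳ (x ⊕ 𝟙)) (x⊙y⊑y (x ⊕ 𝟙) 𝟙)) (y⊑x⊕y x 𝟙)

  ⊕-monoʳ-⊑ : ∀ z {x y} → x ⊑ y → z ⊕ x ⊑ z ⊕ y
  ⊕-monoʳ-⊑ z {x} {y} x⊑y = trans (cong (z ⊕_) x⊑y) (⊕-distribˡ-∧ z x y)

  p⊕q≡p⇒p⊕rq≡p : ∀ {p q} r → p ⊕ q ≡ p → p ⊕ r ⊙ q ≡ p
  p⊕q≡p⇒p⊕rq≡p {p} {q} r p⊕q≡p = antisym
    (⊑-trans (⊕-monoʳ-⊑ p (x⊙y⊑y r q)) (⊑-reflexive p⊕q≡p))
    (⊑-trans (y⊑x⊕y (r ⊙ q) p) (⊑-reflexive (⊕-comm (r ⊙ q) p)))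

  𝟘∣x⇒x≡𝟘 : ∀ {x} → 𝟘 ∣ x → x ≡ 𝟘
  𝟘∣x⇒x≡𝟘 (q , q⊙𝟘≡x) = trans (sym q⊙𝟘≡x) (⊙-zeroʳ q)

  GoodPair-⊕-⊙ : ∀ x y → GoodPair A (x ⊕ y) (x ⊙ y)
  GoodPair-⊕-⊙ x y = ⊕-good , ⊙-good
    where
    ⊕-good : (x ⊕ y) ⊕ x ⊙ y ≡ x ⊕ y
    ⊕-good = begin
      (x ⊕ y) ⊕ x ⊙ y          ≡⟨ ⊕-comm _ _ ⟩
      x ⊙ y ⊕ (x ⊕ y)          ≡⟨ cong (x ⊙ y ⊕_) (sym (⊙-identityʳ _)) ⟩
      x ⊙ y ⊕ (x ⊕ y) ⊙ 𝟙      ≡⟨ ax2 x y 𝟙 ⟩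
      (x ⊕ y ⊙ 𝟙) ⊙ (y ⊕ 𝟙)    ≡⟨ cong₂ (λ u v → (x ⊕ u) ⊙ v) (⊙-identityʳ y) (⊕-zeroʳ y) ⟩
      (x ⊕ y) ⊙ 𝟙              ≡⟨ ⊙-identityʳ _ ⟩
      x ⊕ y                    ∎
    ⊙-good : (x ⊕ y) ⊙ (x ⊙ y) ≡ x ⊙ y
    ⊙-good = begin
      (x ⊕ y) ⊙ (x ⊙ y)        ≡⟨ cong ((x ⊕ y) ⊙_) (sym (⊕-identityʳ _)) ⟩
      (x ⊕ y) ⊙ (x ⊙ y ⊕ 𝟘)    ≡⟨ ax1 x y 𝟘 ⟩
      x ⊙ (y ⊕ 𝟘) ⊕ y ⊙ 𝟘      ≡⟨ cong₂ (λ u v → x ⊙ u ⊕ v) (⊕-identityʳ y) (⊙-zeroʳ y) ⟩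
      x ⊙ y ⊕ 𝟘                ≡⟨ ⊕-identityʳ _ ⟩
      x ⊙ y                    ∎

  GoodPair-∣ʳ : ∀ {p q s} → GoodPair A p q → q ∣ s → GoodPair A p s
  GoodPair-∣ʳ {p} {q} (p⊕q≡p , p⊙q≡q) (r , r⊙q≡s) = subst (GoodPair A p) r⊙q≡s
    (p⊕q≡p⇒p⊕rq≡p r p⊕q≡p , trans (⊙-x∙yz≡y∙xz p r q) (cong (r ⊙_) p⊙q≡q))

  GoodPair-∨ʳ : ∀ {p q s} → GoodPair A p q → GoodPair A p s → GoodPair A p (q ∨ s)
  GoodPair-∨ʳ {p} {q} {s} (p⊕q≡p , p⊙q≡q) (p⊕s≡p , p⊙s≡s) =
    trans (⊕-distribˡ-∨ p q s) (trans (cong₂ _∨_ p⊕q≡p p⊕s≡p) (∨-idem p)) ,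
    trans (⊙-distribˡ-∨ p q s) (cong₂ _∨_ p⊙q≡q p⊙s≡s)

  GoodPair-⊙ˡ : ∀ {p q r} → GoodPair A p q → GoodPair A r q → GoodPair A (p ⊙ r) q
  GoodPair-⊙ˡ {p} {q} {r} (p⊕q≡p , p⊙q≡q) (r⊕q≡r , r⊙q≡q) = ⊕-good , ⊙-good
    where
    q⊕r≡r : q ⊕ r ≡ r
    q⊕r≡r = trans (⊕-comm q r) r⊕q≡r
    q⊙r≡q : q ⊙ r ≡ q
    q⊙r≡q = trans (⊙-comm q r) r⊙q≡q
    ⊕-good : p ⊙ r ⊕ q ≡ p ⊙ r
    ⊕-good = begin
      p ⊙ r ⊕ q                ≡⟨ cong₂ (λ u v → p ⊙ u ⊕ v) (sym q⊕r≡r) (sym q⊙r≡q) ⟩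
      p ⊙ (q ⊕ r) ⊕ q ⊙ r      ≡⟨ sym (ax1 p q r) ⟩
      (p ⊕ q) ⊙ (p ⊙ q ⊕ r)    ≡⟨ cong₂ (λ u v → u ⊙ (v ⊕ r)) p⊕q≡p p⊙q≡q ⟩
      p ⊙ (q ⊕ r)              ≡⟨ cong (p ⊙_) q⊕r≡r ⟩
      p ⊙ r                    ∎
    ⊙-good : p ⊙ r ⊙ q ≡ q
    ⊙-good = trans (⊙-assoc p r q) (trans (cong (p ⊙_) r⊙q≡q) p⊙q≡q)

  GoodPair-⊕ʳ : ∀ {u v} z → GoodPair A u v → GoodPair A (u ⊕ z) (u ⊙ (v ⊕ z))
  GoodPair-⊕ʳ {u} {v} z (u⊕v≡u , u⊙v≡v) = ⊕-good , ⊙-good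
    where
    v⊕uz≡u[v⊕z] : v ⊕ u ⊙ z ≡ u ⊙ (v ⊕ z)
    v⊕uz≡u[v⊕z] = begin
      v ⊕ u ⊙ z                ≡⟨ cong₂ (λ s t → s ⊕ t ⊙ z) (sym u⊙v≡v) (sym u⊕v≡u) ⟩
      u ⊙ v ⊕ (u ⊕ v) ⊙ z      ≡⟨ ax2 u v z ⟩
      (u ⊕ v ⊙ z) ⊙ (v ⊕ z)    ≡⟨ cong (λ w → (u ⊕ w) ⊙ (v ⊕ z)) (⊙-comm v z) ⟩
      (u ⊕ z ⊙ v) ⊙ (v ⊕ z)    ≡⟨ cong (_⊙ (v ⊕ z)) (p⊕q≡p⇒p⊕rq≡p z u⊕v≡u) ⟩
      u ⊙ (v ⊕ z)              ∎
    ⊕-good : (u ⊕ z) ⊕ u ⊙ (v ⊕ z) ≡ u ⊕ z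
    ⊕-good = begin
      (u ⊕ z) ⊕ u ⊙ (v ⊕ z)    ≡⟨ cong ((u ⊕ z) ⊕_) (sym v⊕uz≡u[v⊕z]) ⟩
      (u ⊕ z) ⊕ (v ⊕ u ⊙ z)    ≡⟨ ⊕-interchange u z v (u ⊙ z) ⟩
      (u ⊕ v) ⊕ (z ⊕ u ⊙ z)    ≡⟨ cong (_⊕ (z ⊕ u ⊙ z)) u⊕v≡u ⟩
      u ⊕ (z ⊕ u ⊙ z)          ≡⟨ sym (⊕-assoc u z (u ⊙ z)) ⟩
      (u ⊕ z) ⊕ u ⊙ z          ≡⟨ proj₁ (GoodPair-⊕-⊙ u z) ⟩
      u ⊕ z                    ∎
    ⊙-good : (u ⊕ z) ⊙ (u ⊙ (v ⊕ z)) ≡ u ⊙ (v ⊕ z)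
    ⊙-good = begin
      (u ⊕ z) ⊙ (u ⊙ (v ⊕ z))  ≡⟨ cong ((u ⊕ z) ⊙_) (trans (sym v⊕uz≡u[v⊕z]) (⊕-comm v (u ⊙ z))) ⟩
      (u ⊕ z) ⊙ (u ⊙ z ⊕ v)    ≡⟨ ax1 u z v ⟩
      u ⊙ (z ⊕ v) ⊕ z ⊙ v      ≡⟨ cong₂ (λ s t → u ⊙ s ⊕ t) (⊕-comm z v) (⊙-comm z v) ⟩
      u ⊙ (v ⊕ z) ⊕ v ⊙ z      ≡⟨ sym (ax1 u v z) ⟩
      (u ⊕ v) ⊙ (u ⊙ v ⊕ z)    ≡⟨ cong₂ (λ s t → s ⊙ (t ⊕ z)) u⊕v≡u u⊙v≡v ⟩
      u ⊙ (v ⊕ z)              ∎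

  GoodPair-sum : ∀ {x₀ x₁ y₀ y₁} → GoodPair A x₀ x₁ → GoodPair A y₀ y₁ →
    GoodPair A (x₀ ⊕ y₀) ((x₀ ⊕ y₁) ⊙ (x₁ ⊕ y₀))
  GoodPair-sum {x₀} {x₁} {y₀} {y₁} x-good@(x₀⊕x₁≡x₀ , x₀⊙x₁≡x₁) y-good =
    subst (GoodPair A (x₀ ⊕ y₀)) (sym split) (GoodPair-∨ʳ left right)
    where
    left : GoodPair A (x₀ ⊕ y₀) ((x₀ ⊕ y₁) ⊙ (x₀ ⊙ (x₁ ⊕ y₀)))
    left = GoodPair-∣ʳ (GoodPair-⊕ʳ y₀ x-good) (x∣ʳyx _ (x₀ ⊕ y₁))
    right : GoodPair A (x₀ ⊕ y₀) ((x₀ ⊕ y₁) ⊙ y₀)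
    right = subst₂ (GoodPair A) (⊕-comm y₀ x₀) (trans (⊙-comm y₀ (y₁ ⊕ x₀)) (cong (_⊙ y₀) (⊕-comm y₁ x₀)))
      (GoodPair-⊕ʳ x₀ y-good)
    x₁⊕y₀-split : x₁ ⊕ y₀ ≡ x₀ ⊙ (x₁ ⊕ y₀) ∨ y₀
    x₁⊕y₀-split = begin
      x₁ ⊕ y₀                                ≡⟨ cong (_⊕ y₀) (sym x₀⊙x₁≡x₁) ⟩
      x₀ ⊙ x₁ ⊕ y₀                           ≡⟨ ax3 x₀ x₁ y₀ ⟩
      (x₀ ⊕ x₁) ⊙ (x₀ ⊙ x₁ ⊕ y₀) ∨ y₀        ≡⟨ cong₂ (λ s t → s ⊙ (t ⊕ y₀) ∨ y₀) x₀⊕x₁≡x₀ x₀⊙x₁≡x₁ ⟩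
      x₀ ⊙ (x₁ ⊕ y₀) ∨ y₀                    ∎
    split : (x₀ ⊕ y₁) ⊙ (x₁ ⊕ y₀) ≡ (x₀ ⊕ y₁) ⊙ (x₀ ⊙ (x₁ ⊕ y₀)) ∨ (x₀ ⊕ y₁) ⊙ y₀
    split = trans (cong ((x₀ ⊕ y₁) ⊙_) x₁⊕y₀-split) (⊙-distribˡ-∨ _ _ _)

  ⊙-upTo-last∣ : ∀ g k → g k ∣ ⊙-upTo A g k
  ⊙-upTo-last∣ g zero    = ∣ʳ-refl
  ⊙-upTo-last∣ g (suc k) = x∣ʳyx (g (suc k)) (⊙-upTo A g k)

  ⊙-upTo-∣-mono : ∀ g {i k} → i ≤ k → ⊙-upTo A g i ∣ ⊙-upTo A g k
  ⊙-upTo-∣-mono g {i} i≤k = go (≤⇒≤′ i≤k)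
    where
    go : ∀ {k} → i ≤′ k → ⊙-upTo A g i ∣ ⊙-upTo A g k
    go ≤′-refl        = ∣ʳ-refl
    go (≤′-step i≤′k) = ∣ʳ-trans (go i≤′k) (x∣xy _ _)

  ⊙-upTo-factor∣ : ∀ g {i k} → i ≤ k → g i ∣ ⊙-upTo A g k
  ⊙-upTo-factor∣ g {i} i≤k = ∣ʳ-trans (⊙-upTo-last∣ g i) (⊙-upTo-∣-mono g i≤k)

  ⊙-upTo-adjacent∣ : ∀ g {i k} → i ≤ k → g i ⊙ g (suc i) ∣ ⊙-upTo A g (suc k)
  ⊙-upTo-adjacent∣ g {i} i≤k =
    ∣ʳ-trans (x∣ʳy⇒xz∣ʳyz (g (suc i)) (⊙-upTo-last∣ g i)) (⊙-upTo-∣-mono g (s≤s i≤k))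

  ⊙-upTo-GoodPair : ∀ f {q} k → (∀ i → i ≤ k → GoodPair A (f i) q) → GoodPair A (⊙-upTo A f k) q
  ⊙-upTo-GoodPair f zero    good = good zero z≤n
  ⊙-upTo-GoodPair f (suc k) good =
    GoodPair-⊙ˡ (⊙-upTo-GoodPair f k (λ i i≤k → good i (m≤n⇒m≤1+n i≤k))) (good (suc k) ≤-refl)

  Eventually𝟘 : (ℕ → Carrier) → Set ℓ
  Eventually𝟘 a = ∃ λ N → ∀ n → N ≤ n → a n ≡ 𝟘

  seqSum-eventually𝟘 : ∀ {a b} → Eventually𝟘 a → Eventually𝟘 b → Eventually𝟘 (seqSum A a b)
  seqSum-eventually𝟘 {a} {b} (N , a≡𝟘) (M , b≡𝟘) = M + N , λ n M+N≤n →
    𝟘∣x⇒x≡𝟘 (subst (_∣ seqSum A a b n) (factor≡𝟘 n M+N≤n) (⊙-upTo-factor∣ _ (m+n≤o⇒n≤o M M+N≤n)))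
    where
    factor≡𝟘 : ∀ n → M + N ≤ n → a N ⊕ b (n ∸ N) ≡ 𝟘
    factor≡𝟘 n M+N≤n =
      trans (cong₂ _⊕_ (a≡𝟘 N ≤-refl) (b≡𝟘 (n ∸ N) (m+n≤o⇒m≤o∸n M M+N≤n))) (⊕-identityʳ 𝟘)

  seqSum-goodPairs : ∀ {a b} →
    (∀ n → GoodPair A (a n) (a (suc n))) → (∀ n → GoodPair A (b n) (b (suc n))) →
    ∀ n → GoodPair A (seqSum A a b n) (seqSum A a b (suc n))
  seqSum-goodPairs {a} {b} a-good b-good n = ⊙-upTo-GoodPair _ n λ i i≤n →
    GoodPair-∣ʳ (GoodPair-sum (a-good i) (b-good (n ∸ i)))
      (subst (λ m → (a i ⊕ b m) ⊙ (a (suc i) ⊕ b (n ∸ i)) ∣ seqSum A a b (suc n))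
        (+-∸-assoc 1 i≤n) (⊙-upTo-adjacent∣ _ i≤n))

proposition7p10 : ∀ {ℓ : Level} (A : MVMonoidal ℓ) (a b : ℕ → MVMonoidal.Carrier A) →
    GoodSeq A a → GoodSeq A b → GoodSeq A (seqSum A a b)
proposition7p10 A a b (a-eventually𝟘 , a-good) (b-eventually𝟘 , b-good) =
  seqSum-eventually𝟘 a-eventually𝟘 b-eventually𝟘 , seqSum-goodPairs a-good b-good
  where open MVMonoidalProperties A
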